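{- Let $N$ be an odd positive integer and $k \ge 1$. If $k$ is odd and $\gcd\!\left(\frac{\pi_N(k+1)}{\pi_N(k)}, N\right) > 1$, then \[ \frac{\pi_N(k+1)}{\pi_N(k)} \sum_{i=0}^{\pi_N(k)-1} p_{\le k}(i) \equiv 0 \pmod{N}. \] Otherwise, $\sum_{i=0}^{\pi_N(k)-1} p_{\le k}(i) \equiv 0 \pmod{N}$.
   Context: $p_{\le k}(n)$ denotes the number of partitions of $n$ with at most $k$ parts. For a modulus $N$, $(p_{\le k}(n)\bmod N)_{n\ge 0}$ is purely periodic and $\pi_N(k)$ denotes its minimal period; $\pi_N(k)$ divides $\pi_N(k+1)$. -}

module Defs where

open import Data.Nat using (ℕ; zero; suc; _+_; _*_; _∸_; _<_; _≤_; _≤?_; NonZero)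
open import Relation.Nullary using (yes; no)
open import Data.Nat.DivMod using (_%_)
open import Data.Product using (_×_)
open import Relation.Binary.PropositionalEquality using (_≡_)

sumTo : ℕ → (ℕ → ℕ) → ℕ
sumTo zero    f = 0
sumTo (suc m) f = sumTo m f + f m

-- parts k n = p_{≤k}(n): number of partitions of n with at most k parts,
-- equivalently (conjugation) partitions of n into parts of size ≤ k.
-- p_{≤0}(n) = [n = 0];  p_{≤k+1}(n) = Σ_{j ≥ 0, j(k+1) ≤ n} p_{≤k}(n − j(k+1))
-- (j = number of parts equal to k+1; j ranges over 0..n, out-of-range terms vanish).
parts : ℕ → ℕ → ℕ
parts zero zero    = 1
parts zero (suc n) = 0
parts (suc k) n    = sumTo (suc n) λ j → term j
  where
  term : ℕ → ℕ
  term j with j * suc k ≤? n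
  ... | yes _ = parts k (n ∸ j * suc k)
  ... | no  _ = 0

IsPeriod : (N : ℕ) → .{{NonZero N}} → ℕ → ℕ → Set
IsPeriod N k T = (0 < T) × (∀ n → parts k (n + T) % N ≡ parts k n % N)

IsMinPeriod : (N : ℕ) → .{{NonZero N}} → ℕ → ℕ → Set
IsMinPeriod N k T = IsPeriod N k T × (∀ T′ → IsPeriod N k T′ → T ≤ T′)

-- Let P be the periodic extension of p_{≤k} mod N to ℤ and L_k = k(k+1)/2. A periodic function
-- that agrees on ℕ with p_{≤k}(x) − (−1)^k p_{≤k}(−L_k − x) (p_{≤k} vanishing on negative
-- arguments) agrees with it everywhere: induct on k, using p_{≤k+1}(x) − p_{≤k+1}(x − k − 1) = p_{≤k}(x).
-- Hence P(−L_k − i) ≡ (−1)^{k+1} p_{≤k}(i), and summing P over a period read at these negative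
-- arguments gives S ≡ (−1)^{k+1} S for S = Σ_{i<π_N(k)} p_{≤k}(i); for even k and odd N, S ≡ 0.
-- Summing p_{≤k+1}(n+k+1) = p_{≤k}(n+k+1) + p_{≤k+1}(n) over a period π_N(k+1) = q π_N(k) of
-- p_{≤k+1} cancels the p_{≤k+1} terms and leaves q S ≡ 0 for every k, so S ≡ 0 when gcd(q, N) = 1.

module Submission where

open import Data.Nat.Base using (ℕ; NonZero)

module Congruence where

  open import Data.Integer.Base using (ℤ; +_; -[1+_]; 0ℤ; 1ℤ; _+_; _-_; -_; _*_; _%ℕ_; _/ℕ_)
  open import Data.Integer.Properties using (+-inverseʳ; +-identityʳ; *-identityʳ)
  open import Data.Integer.DivMod using (a≡a%ℕn+[a/ℕn]*n)
  open import Data.Integer.Divisibility.Signed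
    using (_∣_; divides; ∣m∣n⇒∣m+n; ∣m⇒∣-m; ∣n⇒∣m*n; ∣⇒∣ᵤ)
  open import Data.Integer.Tactic.RingSolver using (solve-∀)
  open import Data.Nat.Base as ℕ using (ℕ; suc; NonZero; _%_)
  import Data.Nat.Divisibility as ℕ
  open import Data.Product using (∃; _,_)
  open import Data.Sum using (_⊎_; inj₁; inj₂)
  open import Level using (0ℓ)
  open import Relation.Binary.Bundles using (Setoid)
  open import Relation.Binary.PropositionalEquality using (_≡_; refl; sym; trans; cong; subst)

  infix 4 _≡_mod_
  record _≡_mod_ (x y : ℤ) (m : ℕ) : Set where
    constructor by-divisibility
    field
      divides-difference : + m ∣ x - y

  mod-reflexive : ∀ {m x y} → x ≡ y → x ≡ y mod m
  mod-reflexive {x = x} refl = by-divisibility (divides 0ℤ (+-inverseʳ x))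

  mod-sym : ∀ {m x y} → x ≡ y mod m → y ≡ x mod m
  mod-sym {x = x} {y} (by-divisibility p) = by-divisibility (subst (_ ∣_) (negate-difference x y) (∣m⇒∣-m p))
    where
    negate-difference : ∀ x y → - (x - y) ≡ y - x
    negate-difference = solve-∀

  mod-trans : ∀ {m x y u} → x ≡ y mod m → y ≡ u mod m → x ≡ u mod m
  mod-trans {x = x} {y} {u} (by-divisibility p) (by-divisibility q) =
    by-divisibility (subst (_ ∣_) (chain-differences x y u) (∣m∣n⇒∣m+n p q))
    where
    chain-differences : ∀ x y u → (x - y) + (y - u) ≡ x - u
    chain-differences = solve-∀

  mod-+ : ∀ {m x y u v} → x ≡ y mod m → u ≡ v mod m → x + u ≡ y + v mod m
  mod-+ {x = x} {y} {u} {v} (by-divisibility p) (by-divisibility q) =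
    by-divisibility (subst (_ ∣_) (add-differences x y u v) (∣m∣n⇒∣m+n p q))
    where
    add-differences : ∀ x y u v → (x - y) + (u - v) ≡ (x + u) - (y + v)
    add-differences = solve-∀

  mod-neg : ∀ {m x y} → x ≡ y mod m → - x ≡ - y mod m
  mod-neg {x = x} {y} (by-divisibility p) = by-divisibility (subst (_ ∣_) (negate-difference x y) (∣m⇒∣-m p))
    where
    negate-difference : ∀ x y → - (x - y) ≡ - x - - y
    negate-difference = solve-∀

  mod-+ˡ : ∀ {m x y} u → x ≡ y mod m → u + x ≡ u + y mod m
  mod-+ˡ u = mod-+ (mod-reflexive {x = u} refl)

  mod-minus : ∀ {m x y u v} → x ≡ y mod m → u ≡ v mod m → x - u ≡ y - v mod m
  mod-minus p q = mod-+ p (mod-neg q)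

  mod-*ˡ : ∀ {m x y} c → x ≡ y mod m → c * x ≡ c * y mod m
  mod-*ˡ {x = x} {y} c (by-divisibility p) = by-divisibility (subst (_ ∣_) (scale-difference c x y) (∣n⇒∣m*n c p))
    where
    scale-difference : ∀ c x y → c * (x - y) ≡ c * x - c * y
    scale-difference = solve-∀

  mod-cancelˡ : ∀ {m x y} u → u + x ≡ u + y mod m → x ≡ y mod m
  mod-cancelˡ {x = x} {y} u (by-divisibility p) = by-divisibility (subst (_ ∣_) (cancel-difference u x y) p)
    where
    cancel-difference : ∀ u x y → (u + x) - (u + y) ≡ x - y
    cancel-difference = solve-∀

  mod-+-cancel : ∀ {m x y} → x + y ≡ y mod m → x ≡ 0ℤ mod m
  mod-+-cancel {x = x} {y} (by-divisibility p) = by-divisibility (subst (_ ∣_) (cancel-difference x y) p)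
    where
    cancel-difference : ∀ x y → (x + y) - y ≡ x - 0ℤ
    cancel-difference = solve-∀

  mod⇒difference-0 : ∀ {m x y} → x ≡ y mod m → x - y ≡ 0ℤ mod m
  mod⇒difference-0 {x = x} {y} (by-divisibility p) = by-divisibility (subst (_ ∣_) (sym (+-identityʳ (x - y))) p)

  difference-0⇒mod : ∀ {m x y} → x - y ≡ 0ℤ mod m → x ≡ y mod m
  difference-0⇒mod {x = x} {y} (by-divisibility p) = by-divisibility (subst (_ ∣_) (+-identityʳ (x - y)) p)

  mod-exchange : ∀ {m a b c d} → a - b ≡ c - d mod m → a - c ≡ b - d mod m
  mod-exchange {a = a} {b} {c} {d} (by-divisibility p) = by-divisibility (subst (_ ∣_) (exchange a b c d) p)
    where
    exchange : ∀ a b c d → (a - b) - (c - d) ≡ (a - c) - (b - d)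
    exchange = solve-∀

  mod-+m : ∀ {m} x → x + + m ≡ x mod m
  mod-+m {m} x = by-divisibility (divides 1ℤ (shift-difference x (+ m)))
    where
    shift-difference : ∀ x m → (x + m) - x ≡ 1ℤ * m
    shift-difference = solve-∀

  mod-1 : ∀ {x y} → x ≡ y mod 1
  mod-1 {x} {y} = by-divisibility (divides (x - y) (sym (*-identityʳ (x - y))))

  mod-split : ∀ {m x y} → x ≡ y mod m → (∃ λ t → x ≡ y + + t * + m) ⊎ (∃ λ t → y ≡ x + + t * + m)
  mod-split {m} {x} {y} (by-divisibility (divides (+ t) eq)) =
    inj₁ (t , trans (add-difference x y) (cong (λ d → y + d) eq))
    where
    add-difference : ∀ x y → x ≡ y + (x - y)
    add-difference = solve-∀
  mod-split {m} {x} {y} (by-divisibility (divides -[1+ t ] eq)) =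
    inj₂ (suc t , trans (subtract-difference x y)
                        (trans (cong (λ d → x - d) eq) (subtract-negative x (+ suc t) (+ m))))
    where
    subtract-difference : ∀ x y → y ≡ x - (x - y)
    subtract-difference = solve-∀
    subtract-negative : ∀ x c m → x - (- c) * m ≡ x + c * m
    subtract-negative = solve-∀

  %ℕ-mod : ∀ {m} .{{_ : NonZero m}} x → x ≡ + (x %ℕ m) mod m
  %ℕ-mod {m} x =
    subst (_≡ + (x %ℕ m) mod m) (sym (a≡a%ℕn+[a/ℕn]*n x m))
      (by-divisibility (divides (x /ℕ m) (remainder-difference (+ (x %ℕ m)) (x /ℕ m) (+ m))))
    where
    remainder-difference : ∀ r q m → (r + q * m) - r ≡ q * m
    remainder-difference = solve-∀

  %-mod : ∀ {m a b} .{{_ : NonZero m}} → a % m ≡ b % m → + a ≡ + b mod m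
  %-mod {a = a} {b} eq = mod-trans (%ℕ-mod (+ a)) (mod-trans (mod-reflexive (cong +_ eq)) (mod-sym (%ℕ-mod (+ b))))

  mod-0⇒∣ : ∀ {m a} → + a ≡ 0ℤ mod m → m ℕ.∣ a
  mod-0⇒∣ {m} {a} (by-divisibility p) = ∣⇒∣ᵤ (subst (+ m ∣_) (+-identityʳ (+ a)) p)

  ℤ-mod : ℕ → Setoid 0ℓ 0ℓ
  ℤ-mod m = record
    { Carrier       = ℤ
    ; _≈_           = λ x y → x ≡ y mod m
    ; isEquivalence = record { refl = mod-reflexive refl ; sym = mod-sym ; trans = mod-trans }
    }

module Sums where

  open import Data.Integer.Base using (ℤ; +_; 0ℤ; _+_; _*_)
  open import Data.Integer.Properties using (+-identityʳ; +-assoc; +-comm; pos-+; *-distribˡ-+; *-zeroʳ)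
  open import Data.Integer.Tactic.RingSolver using (solve-∀)
  open import Data.Nat.Base as ℕ using (ℕ; zero; suc; _∸_; _<_)
  import Data.Nat.Properties as ℕ
  open import Defs using (sumTo)
  open import Relation.Binary.PropositionalEquality using (_≡_; refl; sym; trans; cong)
  open Congruence

  ∑ : ℕ → (ℕ → ℤ) → ℤ
  ∑ zero    f = 0ℤ
  ∑ (suc n) f = ∑ n f + f n

  infixl 10 ∑
  syntax ∑ n (λ i → e) = ∑[ i < n ] e

  ∑-cong : ∀ {m} n {f g : ℕ → ℤ} → (∀ i → i < n → f i ≡ g i mod m) → ∑ n f ≡ ∑ n g mod m
  ∑-cong zero    eq = mod-reflexive refl
  ∑-cong (suc n) eq = mod-+ (∑-cong n (λ i i<n → eq i (ℕ.m<n⇒m<1+n i<n))) (eq n ℕ.≤-refl)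

  ∑-unshift : ∀ n (f : ℕ → ℤ) → ∑ (suc n) f ≡ f 0 + ∑[ i < n ] f (suc i)
  ∑-unshift zero    f = +-comm 0ℤ (f 0)
  ∑-unshift (suc n) f = trans (cong (_+ f (suc n)) (∑-unshift n f)) (+-assoc (f 0) _ _)

  ∑-+ : ∀ m n (f : ℕ → ℤ) → ∑ (m ℕ.+ n) f ≡ ∑ m f + ∑[ i < n ] f (m ℕ.+ i)
  ∑-+ m zero    f rewrite ℕ.+-identityʳ m = sym (+-identityʳ (∑ m f))
  ∑-+ m (suc n) f rewrite ℕ.+-suc m n = trans (cong (_+ f (m ℕ.+ n)) (∑-+ m n f)) (+-assoc (∑ m f) _ _)

  ∑-distrib-+ : ∀ n (f g : ℕ → ℤ) → ∑[ i < n ] (f i + g i) ≡ ∑ n f + ∑ n g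
  ∑-distrib-+ zero    f g = refl
  ∑-distrib-+ (suc n) f g =
    trans (cong (_+ (f n + g n)) (∑-distrib-+ n f g)) (interchange (∑ n f) (∑ n g) (f n) (g n))
    where
    interchange : ∀ a b c d → (a + b) + (c + d) ≡ (a + c) + (b + d)
    interchange = solve-∀

  ∑-*ˡ : ∀ n c (f : ℕ → ℤ) → ∑[ i < n ] (c * f i) ≡ c * ∑ n f
  ∑-*ˡ zero    c f = sym (*-zeroʳ c)
  ∑-*ˡ (suc n) c f = trans (cong (_+ c * f n) (∑-*ˡ n c f)) (sym (*-distribˡ-+ c (∑ n f) (f n)))

  ∑-reverse : ∀ n (f : ℕ → ℤ) → ∑[ i < n ] f (n ∸ suc i) ≡ ∑ n f
  ∑-reverse zero    f = refl
  ∑-reverse (suc n) f =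
    trans (∑-unshift n (λ i → f (suc n ∸ suc i)))
          (trans (cong (λ s → f n + s) (∑-reverse n f)) (+-comm (f n) (∑ n f)))

  ∑-pos : ∀ n (f : ℕ → ℕ) → ∑[ i < n ] (+ f i) ≡ + sumTo n f
  ∑-pos zero    f = refl
  ∑-pos (suc n) f = trans (cong (_+ + f n) (∑-pos n f)) (sym (pos-+ (sumTo n f) (f n)))

module Periodicity (N : ℕ) where

  open import Data.Integer.Base using (ℤ; +_; -[1+_]; 0ℤ; 1ℤ; _+_; _-_; _*_; ∣_∣; _%ℕ_)
  open import Data.Integer.Properties using (+-identityʳ; +-assoc; +-comm; +-injective; pos-*; ⊖-≥)
  open import Data.Integer.Tactic.RingSolver using (solve-∀)
  open import Data.Nat.Base as ℕ using (ℕ; zero; suc; NonZero; _%_)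
  import Data.Nat.Properties as ℕ
  open import Data.Product using (∃; _,_)
  open import Data.Sum using (inj₁; inj₂)
  open import Relation.Binary.PropositionalEquality using (_≡_; refl; sym; trans; cong)
  open Congruence
  open Sums
  open import Relation.Binary.Reasoning.Setoid (ℤ-mod N)

  infix 4 _≈_
  _≈_ : ℤ → ℤ → Set
  x ≈ y = x ≡ y mod N

  Periodic : ℕ → (ℤ → ℤ) → Set
  Periodic M F = ∀ x → F (x + + M) ≈ F x

  periodic-iterate : ∀ {M F} → Periodic M F → ∀ t x → F (x + + t * + M) ≈ F x
  periodic-iterate {M} {F} periodic zero    x = mod-reflexive (cong F (+-identityʳ x))
  periodic-iterate {M} {F} periodic (suc t) x = begin
    F (x + + suc t * + M)       ≡⟨ cong F (one-more-period x (+ t) (+ M)) ⟩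
    F ((x + + t * + M) + + M)   ≈⟨ periodic (x + + t * + M) ⟩
    F (x + + t * + M)           ≈⟨ periodic-iterate periodic t x ⟩
    F x                         ∎
    where
    one-more-period : ∀ x t m → x + (1ℤ + t) * m ≡ (x + t * m) + m
    one-more-period = solve-∀

  periodic-resp : ∀ {M F x y} → Periodic M F → x ≡ y mod M → F x ≈ F y
  periodic-resp {F = F} periodic x≡y with mod-split x≡y
  ... | inj₁ (t , x≡) = mod-trans (mod-reflexive (cong F x≡)) (periodic-iterate periodic t _)
  ... | inj₂ (t , y≡) = mod-sym (mod-trans (mod-reflexive (cong F y≡)) (periodic-iterate periodic t _))

  ∑-window : ∀ {M F} → Periodic M F → ∀ x y → ∑[ i < M ] F (x + + i) ≈ ∑[ i < M ] F (y + + i)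
  ∑-window {M} {F} periodic x y = periodic-resp {F = W} {x} {y} slide mod-1
    where
    W : ℤ → ℤ
    W x = ∑[ i < M ] F (x + + i)
    slide : Periodic 1 W
    slide x = mod-cancelˡ (F x) (begin
      F x + W (x + + 1)                   ≈⟨ mod-+ (mod-reflexive (cong F (sym (+-identityʳ x))))
                                                   (∑-cong M (λ i _ → mod-reflexive (cong F (+-assoc x (+ 1) (+ i))))) ⟩
      F (x + + 0) + ∑[ i < M ] F (x + + suc i) ≡⟨ ∑-unshift M (λ i → F (x + + i)) ⟨
      W x + F (x + + M)                   ≈⟨ mod-+ˡ (W x) (periodic x) ⟩
      W x + F x                           ≡⟨ +-comm (W x) (F x) ⟩
      F x + W x                           ∎)

  ∑-periods : ∀ {M F} → Periodic M F →
              ∀ q x → ∑[ i < q ℕ.* M ] F (x + + i) ≈ + q * ∑[ i < M ] F (x + + i)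
  ∑-periods {M} {F} periodic zero    x = mod-reflexive refl
  ∑-periods {M} {F} periodic (suc q) x = begin
    ∑[ i < M ℕ.+ q ℕ.* M ] F (x + + i)                     ≡⟨ ∑-+ M (q ℕ.* M) (λ i → F (x + + i)) ⟩
    W + ∑[ i < q ℕ.* M ] F (x + + (M ℕ.+ i))               ≈⟨ mod-+ˡ W (∑-cong (q ℕ.* M) (λ i _ → shifted i)) ⟩
    W + ∑[ i < q ℕ.* M ] F (x + + i)                       ≈⟨ mod-+ˡ W (∑-periods periodic q x) ⟩
    W + + q * W                                            ≡⟨ one-more-copy W (+ q) ⟩
    + suc q * W                                            ∎
    where
    W : ℤ
    W = ∑[ i < M ] F (x + + i)
    reassociate : ∀ x m i → x + (m + i) ≡ (x + i) + m
    reassociate = solve-∀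
    shifted : ∀ i → F (x + + (M ℕ.+ i)) ≈ F (x + + i)
    shifted i = mod-trans (mod-reflexive (cong F (reassociate x (+ M) (+ i)))) (periodic (x + + i))
    one-more-copy : ∀ w q → w + q * w ≡ (1ℤ + q) * w
    one-more-copy = solve-∀

  Δ : ℕ → (ℤ → ℤ) → ℤ → ℤ
  Δ K F x = F x - F (x - + K)

  Δ-periodic : ∀ {M F} K → Periodic M F → Periodic M (Δ K F)
  Δ-periodic {M} {F} K periodic x =
    mod-minus (periodic x) (mod-trans (mod-reflexive (cong F (shift-past x (+ M) (+ K)))) (periodic (x - + K)))
    where
    shift-past : ∀ x m k → (x + m) - k ≡ (x - k) + m
    shift-past = solve-∀

  Δ-agree⇒periodic : ∀ {K F G} → (∀ x → Δ K F x ≈ Δ K G x) → Periodic K (λ x → F x - G x)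
  Δ-agree⇒periodic {K} {F} {G} agree x = mod-exchange {a = F (x + + K)} {F x} {G (x + + K)} {G x} (begin
    F (x + + K) - F x                   ≡⟨ cong (λ u → F (x + + K) - F u) (cancel x (+ K)) ⟨
    Δ K F (x + + K)                     ≈⟨ agree (x + + K) ⟩
    Δ K G (x + + K)                     ≡⟨ cong (λ u → G (x + + K) - G u) (cancel x (+ K)) ⟩
    G (x + + K) - G x                   ∎)
    where
    cancel : ∀ x k → (x + k) - k ≡ x
    cancel = solve-∀

  translate-to-ℕ : ∀ M .{{_ : NonZero M}} d → ∃ λ n → d + + ∣ d ∣ * + M ≡ + n
  translate-to-ℕ M (+ a)      = a ℕ.+ a ℕ.* M , cong (λ t → + a + t) (sym (pos-* a M))
  translate-to-ℕ M -[1+ a ]   =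
    suc a ℕ.* M ℕ.∸ suc a ,
    trans (cong (λ t → -[1+ a ] + t) (sym (pos-* (suc a) M))) (⊖-≥ (ℕ.m≤m*n (suc a) M))

  eventually-0 : ∀ {M F} .{{_ : NonZero M}} b → Periodic M F →
                 (∀ n → F (b + + n) ≈ 0ℤ) → ∀ x → F x ≈ 0ℤ
  eventually-0 {M} {F} b periodic vanishes x with translate-to-ℕ M (x - b)
  ... | n , translate = begin
    F x                           ≈⟨ periodic-iterate periodic ∣ x - b ∣ x ⟨
    F (x + + ∣ x - b ∣ * + M)     ≡⟨ cong F (trans (rebase x b _) (cong (λ t → b + t) translate)) ⟩
    F (b + + n)                   ≈⟨ vanishes n ⟩
    0ℤ                            ∎
    where
    rebase : ∀ x b t → x + t ≡ b + ((x - b) + t)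
    rebase = solve-∀

  module Extension .{{_ : NonZero N}} {T} .{{_ : NonZero T}} (f : ℕ → ℕ)
                   (periodic : ∀ n → f (n ℕ.+ T) % N ≡ f n % N) where

    iterate : ∀ t a → + f (a ℕ.+ t ℕ.* T) ≈ + f a
    iterate zero    a = mod-reflexive (cong (λ n → + f n) (ℕ.+-identityʳ a))
    iterate (suc t) a = begin
      + f (a ℕ.+ (T ℕ.+ t ℕ.* T))   ≡⟨ cong (λ n → + f n) (move-period a T (t ℕ.* T)) ⟩
      + f (a ℕ.+ t ℕ.* T ℕ.+ T)     ≈⟨ %-mod (periodic (a ℕ.+ t ℕ.* T)) ⟩
      + f (a ℕ.+ t ℕ.* T)           ≈⟨ iterate t a ⟩
      + f a                         ∎
      where
      move-period : ∀ a b c → a ℕ.+ (b ℕ.+ c) ≡ a ℕ.+ c ℕ.+ b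
      move-period a b c = trans (cong (a ℕ.+_) (ℕ.+-comm b c)) (sym (ℕ.+-assoc a c b))

    +-injective-translate : ∀ {a} b t → + a ≡ + b + + t * + T → a ≡ b ℕ.+ t ℕ.* T
    +-injective-translate b t eq = +-injective (trans eq (cong (λ u → + b + u) (sym (pos-* t T))))

    resp : ∀ {a b} → + a ≡ + b mod T → + f a ≈ + f b
    resp {a} {b} a≡b with mod-split a≡b
    ... | inj₁ (t , a≡) =
      mod-trans (mod-reflexive (cong (λ n → + f n) (+-injective-translate b t a≡))) (iterate t b)
    ... | inj₂ (t , b≡) =
      mod-sym (mod-trans (mod-reflexive (cong (λ n → + f n) (+-injective-translate a t b≡))) (iterate t a))

    extend : ℤ → ℤ
    extend x = + f (x %ℕ T)

    extend-+ : ∀ n → extend (+ n) ≈ + f n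
    extend-+ n = resp (mod-sym (%ℕ-mod (+ n)))

    extend-periodic : Periodic T extend
    extend-periodic x = resp (mod-trans (mod-sym (%ℕ-mod (x + + T))) (mod-trans (mod-+m x) (%ℕ-mod x)))

module Partitions where

  open import Data.Nat.Base using (ℕ; zero; suc; _+_; _*_; _∸_; _<_; _≤_; z≤n)
  open import Data.Nat.Properties
  open import Data.Empty using (⊥-elim)
  open import Defs using (sumTo; parts)
  open import Function.Base using (_∘_)
  open import Relation.Nullary using (yes; no)
  open import Relation.Binary.PropositionalEquality
  open ≡-Reasoning

  sumTo-cong : ∀ m {f g : ℕ → ℕ} → (∀ i → f i ≡ g i) → sumTo m f ≡ sumTo m g
  sumTo-cong zero    eq = refl
  sumTo-cong (suc m) eq = cong₂ _+_ (sumTo-cong m eq) (eq m)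

  sumTo-unshift : ∀ n f → sumTo (suc n) f ≡ f 0 + sumTo n (f ∘ suc)
  sumTo-unshift zero    f = +-comm 0 (f 0)
  sumTo-unshift (suc n) f = trans (cong (_+ f (suc n)) (sumTo-unshift n f)) (+-assoc (f 0) _ _)

  sumTo-zero : ∀ n {f} → (∀ i → f i ≡ 0) → sumTo n f ≡ 0
  sumTo-zero zero    eq = refl
  sumTo-zero (suc n) eq = cong₂ _+_ (sumTo-zero n eq) (eq n)

  sumTo-beyond : ∀ a e {f} → (∀ i → a ≤ i → f i ≡ 0) → sumTo (a + e) f ≡ sumTo a f
  sumTo-beyond a zero    eq = cong (λ n → sumTo n _) (+-identityʳ a)
  sumTo-beyond a (suc e) eq rewrite +-suc a e =
    trans (cong₂ _+_ (sumTo-beyond a e eq) (eq (a + e) (m≤m+n a e))) (+-identityʳ _)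

  summand : ℕ → ℕ → ℕ → ℕ
  summand k n j with j * suc k ≤? n
  ... | yes _ = parts k (n ∸ j * suc k)
  ... | no  _ = 0

  mutual
    parts-suc : ∀ k n → parts (suc k) n ≡ sumTo (suc n) (summand k n)
    parts-suc k n = sumTo-cong (suc n) (parts-suc-term k n)

    -- The _ is the local summand in the definition of parts, which cannot be named;
    -- it is solved from the use in parts-suc.
    parts-suc-term : ∀ k n j → _ ≡ summand k n j
    parts-suc-term k n j with j * suc k ≤? n
    ... | yes _ = refl
    ... | no  _ = refl

  summand-zero : ∀ k n → summand k n 0 ≡ parts k n
  summand-zero k n with 0 ≤? n
  ... | yes _   = refl
  ... | no  0≰n = ⊥-elim (0≰n z≤n)

  summand-vanishes : ∀ k n j → n < j * suc k → summand k n j ≡ 0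
  summand-vanishes k n j n<jK with j * suc k ≤? n
  ... | yes jK≤n = ⊥-elim (<⇒≱ n<jK jK≤n)
  ... | no  _    = refl

  summand-shift : ∀ k n j → summand k (suc k + n) (suc j) ≡ summand k n j
  summand-shift k n j with suc k + j * suc k ≤? suc k + n | j * suc k ≤? n
  ... | yes _       | yes _    = cong (parts k) ([m+n]∸[m+o]≡n∸o (suc k) n (j * suc k))
  ... | yes K+jK≤   | no  jK≰n = ⊥-elim (jK≰n (+-cancelˡ-≤ (suc k) _ _ K+jK≤))
  ... | no  K+jK≰   | yes jK≤n = ⊥-elim (K+jK≰ (+-monoʳ-≤ (suc k) jK≤n))
  ... | no  _       | no  _    = refl

  parts-suc-small : ∀ k n → n < suc k → parts (suc k) n ≡ parts k n
  parts-suc-small k n n<K = begin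
    parts (suc k) n                               ≡⟨ parts-suc k n ⟩
    sumTo (suc n) (summand k n)                   ≡⟨ sumTo-unshift n (summand k n) ⟩
    summand k n 0 + sumTo n (summand k n ∘ suc)   ≡⟨ cong₂ _+_ (summand-zero k n) (sumTo-zero n no-copies) ⟩
    parts k n + 0                                 ≡⟨ +-identityʳ (parts k n) ⟩
    parts k n                                     ∎
    where
    no-copies : ∀ j → summand k n (suc j) ≡ 0
    no-copies j = summand-vanishes k n (suc j) (<-≤-trans n<K (m≤m+n (suc k) (j * suc k)))

  parts-suc-large : ∀ k n → parts (suc k) (suc k + n) ≡ parts k (suc k + n) + parts (suc k) n
  parts-suc-large k n = begin
    parts (suc k) (K + n)                                       ≡⟨ parts-suc k (K + n) ⟩
    sumTo (suc (K + n)) (summand k (K + n))                     ≡⟨ sumTo-unshift (K + n) (summand k (K + n)) ⟩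
    summand k (K + n) 0 + sumTo (K + n) (summand k (K + n) ∘ suc)
      ≡⟨ cong₂ _+_ (summand-zero k (K + n)) (sumTo-cong (K + n) (summand-shift k n)) ⟩
    parts k (K + n) + sumTo (K + n) (summand k n)
      ≡⟨ cong (λ m → parts k (K + n) + sumTo m (summand k n)) K+n≡ ⟩
    parts k (K + n) + sumTo (suc n + k) (summand k n)
      ≡⟨ cong (parts k (K + n) +_) (sumTo-beyond (suc n) k no-copies) ⟩
    parts k (K + n) + sumTo (suc n) (summand k n)               ≡⟨ cong (parts k (K + n) +_) (parts-suc k n) ⟨
    parts k (K + n) + parts (suc k) n                           ∎
    where
    K = suc k
    K+n≡ : K + n ≡ suc n + k
    K+n≡ = cong suc (+-comm k n)
    no-copies : ∀ j → suc n ≤ j → summand k n j ≡ 0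
    no-copies j n<j = summand-vanishes k n j (<-≤-trans n<j (m≤m*n j K))

module Reciprocity where

  open import Data.Integer.Base using (ℤ; +_; -[1+_]; 0ℤ; -1ℤ; _+_; _-_; -_; _*_; _^_; _⊖_)
  open import Data.Integer.Properties using (+-identityʳ; [1+m]⊖[1+n]≡m⊖n; [+m]-[+n]≡m⊖n)
  open import Data.Integer.Tactic.RingSolver using (solve-∀)
  open import Data.Nat.Base as ℕ using (ℕ; zero; suc; _<_; s≤s)
  open import Data.Nat.Properties using (_≤?_)
  import Data.Nat.Properties as ℕ
  open import Defs using (parts)
  open import Data.Product using (_,_)
  open import Relation.Nullary using (yes; no)
  open import Relation.Binary.PropositionalEquality
  open ≡-Reasoning
  open Partitions

  pℤ : ℕ → ℤ → ℤ
  pℤ k (+ n)    = + parts k n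
  pℤ k -[1+ n ] = 0ℤ

  pℤ-⊖ : ∀ k m n → m < n → pℤ k (m ⊖ n) ≡ 0ℤ
  pℤ-⊖ k zero    (suc n) _         = refl
  pℤ-⊖ k (suc m) (suc n) (s≤s m<n) = trans (cong (pℤ k) ([1+m]⊖[1+n]≡m⊖n m n)) (pℤ-⊖ k m n m<n)

  pℤ-suc : ∀ k x → pℤ (suc k) x ≡ pℤ k x + pℤ (suc k) (x - + suc k)
  pℤ-suc k -[1+ n ] = refl
  pℤ-suc k (+ n) with suc k ≤? n
  ... | yes K≤n with ℕ.m≤n⇒∃[o]m+o≡n K≤n
  ...   | m , refl = begin
    + parts (suc k) (suc k ℕ.+ m)                         ≡⟨ cong +_ (parts-suc-large k m) ⟩
    + parts k (suc k ℕ.+ m) + + parts (suc k) m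
      ≡⟨ cong (λ y → + parts k (suc k ℕ.+ m) + pℤ (suc k) y) (cancel (+ suc k) (+ m)) ⟨
    + parts k (suc k ℕ.+ m) + pℤ (suc k) (+ (suc k ℕ.+ m) - + suc k) ∎
    where
    cancel : ∀ a b → (a + b) - a ≡ b
    cancel = solve-∀
  pℤ-suc k (+ n) | no K≰n = begin
    + parts (suc k) n                                     ≡⟨ cong +_ (parts-suc-small k n (ℕ.≰⇒> K≰n)) ⟩
    + parts k n                                           ≡⟨ +-identityʳ (+ parts k n) ⟨
    + parts k n + 0ℤ                                      ≡⟨ cong (λ y → + parts k n + y) below ⟨
    + parts k n + pℤ (suc k) (+ n - + suc k)              ∎
    where
    below : pℤ (suc k) (+ n - + suc k) ≡ 0ℤ
    below = trans (cong (pℤ (suc k)) ([+m]-[+n]≡m⊖n n (suc k))) (pℤ-⊖ (suc k) n (suc k) (ℕ.≰⇒> K≰n))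

  triangular : ℕ → ℕ
  triangular zero    = 0
  triangular (suc j) = suc j ℕ.+ triangular j

  reflected : ℕ → ℤ → ℤ
  reflected j x = pℤ j x - -1ℤ ^ j * pℤ j (- (+ triangular j + x))

  reflected-zero : ∀ x → reflected 0 x ≡ 0ℤ
  reflected-zero (+ zero)    = refl
  reflected-zero (+ suc n)   = refl
  reflected-zero -[1+ n ]    = refl

  reflected-difference : ∀ j x → reflected (suc j) x - reflected (suc j) (x - + suc j) ≡ reflected j x
  reflected-difference j x = begin
    (pℤ K x - s′ * pℤ K (- ((+ K + L) + x))) - (pℤ K (x - + K) - s′ * pℤ K (- ((+ K + L) + (x - + K))))
      ≡⟨ cong₂ (λ u v → (pℤ K x - s′ * pℤ K u) - (pℤ K (x - + K) - s′ * pℤ K v))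
               (shift-out (+ K) L x) (shift-cancel (+ K) L x) ⟩
    (pℤ K x - s′ * pℤ K (y - + K)) - (pℤ K (x - + K) - s′ * pℤ K y)
      ≡⟨ cong₂ (λ u v → (u - s′ * pℤ K (y - + K)) - (pℤ K (x - + K) - s′ * v))
               (pℤ-suc j x) (pℤ-suc j y) ⟩
    ((pℤ j x + pℤ K (x - + K)) - s′ * pℤ K (y - + K)) - (pℤ K (x - + K) - s′ * (pℤ j y + pℤ K (y - + K)))
      ≡⟨ collect (pℤ j x) (pℤ K (x - + K)) (pℤ j y) (pℤ K (y - + K)) s ⟩
    pℤ j x - s * pℤ j y ∎
    where
    K = suc j
    L = + triangular j
    s = -1ℤ ^ j
    s′ = -1ℤ * s
    y = - (L + x)
    shift-out : ∀ k l x → - ((k + l) + x) ≡ - (l + x) - k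
    shift-out = solve-∀
    shift-cancel : ∀ k l x → - ((k + l) + (x - k)) ≡ - (l + x)
    shift-cancel = solve-∀
    collect : ∀ a b c d s → ((a + b) - (-1ℤ * s) * d) - (b - (-1ℤ * s) * (c + d)) ≡ a - s * c
    collect = solve-∀

module PeriodSums (N : ℕ) .{{_ : NonZero N}} where

  open import Data.Integer.Base using (ℤ; +_; -[1+_]; 0ℤ; 1ℤ; -1ℤ; _+_; _-_; -_; _*_; _^_)
  open import Data.Integer.Properties using (pos-*; ⊖-≥)
  open import Data.Integer.Tactic.RingSolver using (solve-∀)
  open import Data.Nat.Base as ℕ using (ℕ; zero; suc; NonZero; >-nonZero; _∸_; _<_; _≤_)
  import Data.Nat.Properties as ℕ
  open import Data.Nat.Divisibility using (_∣_; divides)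
  open import Data.Product using (_,_)
  open import Defs using (sumTo; parts; IsPeriod)
  open import Function.Base using (_∘_)
  open import Relation.Binary.PropositionalEquality using (_≡_; refl; sym; trans; cong; cong₂)
  open Congruence
  open Sums
  open Periodicity N
  open Partitions using (parts-suc-large)
  open Reciprocity
  open import Relation.Binary.Reasoning.Setoid (ℤ-mod N)

  reflected-everywhere : ∀ j {M F} .{{_ : NonZero M}} b → Periodic M F →
                         (∀ n → F (b + + n) ≈ reflected j (b + + n)) → ∀ x → F x ≈ reflected j x
  reflected-everywhere zero {F = F} b periodic agree x = begin
    F x             ≈⟨ eventually-0 b periodic vanishes x ⟩
    0ℤ              ≡⟨ reflected-zero x ⟨
    reflected 0 x   ∎
    where
    vanishes : ∀ n → F (b + + n) ≈ 0ℤ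
    vanishes n = mod-trans (agree n) (mod-reflexive (reflected-zero (b + + n)))
  reflected-everywhere (suc j) {F = F} b periodic agree x =
    difference-0⇒mod (eventually-0 b (Δ-agree⇒periodic {K} {F} {R} ΔF≈ΔR) (mod⇒difference-0 ∘ agree) x)
    where
    K = suc j
    R = reflected K
    regroup : ∀ b k n → (b + k) + n ≡ b + (k + n)
    regroup = solve-∀
    regroup-back : ∀ b k n → ((b + k) + n) - k ≡ b + n
    regroup-back = solve-∀
    ΔF-agree : ∀ n → Δ K F ((b + + K) + + n) ≈ reflected j ((b + + K) + + n)
    ΔF-agree n = begin
      F z - F (z - + K)                     ≡⟨ cong₂ (λ u v → F u - F v) regrouped regrouped-back ⟩
      F (b + + (K ℕ.+ n)) - F (b + + n)     ≈⟨ mod-minus (agree (K ℕ.+ n)) (agree n) ⟩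
      R (b + + (K ℕ.+ n)) - R (b + + n)     ≡⟨ cong₂ (λ u v → R u - R v) regrouped regrouped-back ⟨
      R z - R (z - + K)                     ≡⟨ reflected-difference j z ⟩
      reflected j z                         ∎
      where
      z = (b + + K) + + n
      regrouped = regroup b (+ K) (+ n)
      regrouped-back = regroup-back b (+ K) (+ n)
    ΔF≈ΔR : ∀ x → Δ K F x ≈ Δ K R x
    ΔF≈ΔR x = mod-trans (reflected-everywhere j (b + + K) (Δ-periodic K periodic) ΔF-agree x)
                        (mod-reflexive (sym (reflected-difference j x)))

  N∣q*sum : ∀ k {T T′ q} → IsPeriod N k T → IsPeriod N (suc k) T′ → T′ ≡ q ℕ.* T →
            N ∣ q ℕ.* sumTo T (parts k)
  N∣q*sum k {T} {T′} {q} (T>0 , periodic) (T′>0 , periodic′) T′≡qT = mod-0⇒∣ (begin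
    + (q ℕ.* S)                             ≡⟨ pos-* q S ⟩
    + q * + S                               ≡⟨ cong (+ q *_) (∑-pos T (parts k)) ⟨
    + q * ∑[ n < T ] (+ parts k n)          ≈⟨ mod-*ˡ (+ q) (∑-cong T (λ n _ → mod-sym (P.extend-+ n))) ⟩
    + q * ∑[ n < T ] P (0ℤ + + n)           ≈⟨ mod-*ˡ (+ q) (∑-window P.extend-periodic 0ℤ (+ K)) ⟩
    + q * ∑[ n < T ] P (+ K + + n)          ≈⟨ ∑-periods P.extend-periodic q (+ K) ⟨
    ∑[ n < q ℕ.* T ] P (+ K + + n)          ≡⟨ cong (λ t → ∑[ n < t ] P (+ K + + n)) T′≡qT ⟨
    ∑[ n < T′ ] P (+ K + + n)               ≈⟨ mod-+-cancel sums-over-T′ ⟩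
    0ℤ                                      ∎)
    where
    instance
      T≢0 : NonZero T
      T≢0 = >-nonZero T>0
      T′≢0 : NonZero T′
      T′≢0 = >-nonZero T′>0
    K = suc k
    S = sumTo T (parts k)
    module P = Extension (parts k) periodic
    module A = Extension (parts K) periodic′
    P = P.extend
    A = A.extend
    recurrence : ∀ n → A (+ K + + n) ≈ P (+ K + + n) + A (0ℤ + + n)
    recurrence n = begin
      A (+ (K ℕ.+ n))                         ≈⟨ A.extend-+ (K ℕ.+ n) ⟩
      + parts K (K ℕ.+ n)                     ≡⟨ cong +_ (parts-suc-large k n) ⟩
      + parts k (K ℕ.+ n) + + parts K n       ≈⟨ mod-+ (mod-sym (P.extend-+ (K ℕ.+ n))) (mod-sym (A.extend-+ n)) ⟩
      P (+ (K ℕ.+ n)) + A (+ n)               ∎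
    sums-over-T′ : ∑[ n < T′ ] P (+ K + + n) + ∑[ n < T′ ] A (0ℤ + + n) ≈ ∑[ n < T′ ] A (0ℤ + + n)
    sums-over-T′ = begin
      ∑[ n < T′ ] P (+ K + + n) + ∑[ n < T′ ] A (0ℤ + + n)
        ≡⟨ ∑-distrib-+ T′ (λ n → P (+ K + + n)) (λ n → A (0ℤ + + n)) ⟨
      ∑[ n < T′ ] (P (+ K + + n) + A (0ℤ + + n))
        ≈⟨ ∑-cong T′ (λ n _ → mod-sym (recurrence n)) ⟩
      ∑[ n < T′ ] A (+ K + + n)                             ≈⟨ ∑-window A.extend-periodic (+ K) 0ℤ ⟩
      ∑[ n < T′ ] A (0ℤ + + n)                              ∎

  sum-symmetry : ∀ k {T} → IsPeriod N (suc k) T →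
                 ∑[ i < T ] (+ parts (suc k) i) ≈ -1ℤ ^ k * ∑[ i < T ] (+ parts (suc k) i)
  sum-symmetry k {T} (T>0 , periodic) = begin
    ∑[ i < T ] (+ parts K i)                ≈⟨ ∑-cong T (λ i _ → P.extend-+ i) ⟨
    ∑[ i < T ] P (+ i)                      ≡⟨ ∑-reverse T (λ i → P (+ i)) ⟨
    ∑[ i < T ] P (+ (T ∸ suc i))            ≈⟨ ∑-cong T wrap ⟨
    ∑[ i < T ] P -[1+ i ]                   ≡⟨⟩
    ∑[ i < T ] G (+ 1 + + i)                ≈⟨ ∑-window G-periodic (+ L) (+ 1) ⟨
    ∑[ i < T ] G (+ L + + i)                ≈⟨ ∑-cong T (λ i _ → mirror i) ⟩
    ∑[ i < T ] (-1ℤ ^ k * + parts K i)      ≡⟨ ∑-*ˡ T (-1ℤ ^ k) (λ i → + parts K i) ⟩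
    -1ℤ ^ k * ∑[ i < T ] (+ parts K i)      ∎
    where
    instance
      T≢0 : NonZero T
      T≢0 = >-nonZero T>0
    K = suc k
    L = triangular K
    module P = Extension (parts K) periodic
    P = P.extend
    G : ℤ → ℤ
    G x = P (- x)
    unwind : ∀ x t → - (x + t) + t ≡ - x
    unwind = solve-∀
    G-periodic : Periodic T G
    G-periodic x = mod-sym (mod-trans (mod-reflexive (cong P (sym (unwind x (+ T))))) (P.extend-periodic (- (x + + T))))
    wrap : ∀ i → i < T → P -[1+ i ] ≈ P (+ (T ∸ suc i))
    wrap i i<T = mod-trans (mod-sym (P.extend-periodic -[1+ i ])) (mod-reflexive (cong P (⊖-≥ i<T)))
    -- L is a successor, so pℤ K (- (+ L + + n)) computes to 0ℤ; here and in mirror this is where k ≥ 1 enters.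
    no-correction : ∀ a s → a ≡ a - s * 0ℤ
    no-correction = solve-∀
    reflection : ∀ x → P x ≈ reflected K x
    reflection = reflected-everywhere K 0ℤ P.extend-periodic
                   (λ n → mod-trans (P.extend-+ n) (mod-reflexive (no-correction (+ parts K n) (-1ℤ ^ K))))
    reflect-back : ∀ l i → - (l + - (l + i)) ≡ i
    reflect-back = solve-∀
    flip-sign : ∀ s p → 0ℤ - (-1ℤ * s) * p ≡ s * p
    flip-sign = solve-∀
    mirror : ∀ i → G (+ L + + i) ≈ -1ℤ ^ k * + parts K i
    mirror i = begin
      P (- (+ L + + i))                                      ≈⟨ reflection (- (+ L + + i)) ⟩
      0ℤ - -1ℤ ^ K * pℤ K (- (+ L + - (+ L + + i)))
        ≡⟨ cong (λ y → 0ℤ - -1ℤ ^ K * pℤ K y) (reflect-back (+ L) (+ i)) ⟩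
      0ℤ - -1ℤ ^ K * + parts K i                             ≡⟨ flip-sign (-1ℤ ^ k) (+ parts K i) ⟩
      -1ℤ ^ k * + parts K i                                  ∎

  -1^even : ∀ c → -1ℤ ^ (c ℕ.* 2) ≡ 1ℤ
  -1^even zero    = refl
  -1^even (suc c) = trans (double-negation (-1ℤ ^ (c ℕ.* 2))) (-1^even c)
    where
    double-negation : ∀ x → -1ℤ * (-1ℤ * x) ≡ x
    double-negation = solve-∀

  N∣2*sum : ∀ k {T} → 1 ≤ k → 2 ∣ k → IsPeriod N k T → N ∣ 2 ℕ.* sumTo T (parts k)
  N∣2*sum (suc k) {T} _ (divides (suc c) k≡) period = mod-0⇒∣ (begin
    + (2 ℕ.* S)                       ≡⟨ cong (λ t → + (S ℕ.+ t)) (ℕ.+-identityʳ S) ⟩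
    + S + + S                         ≡⟨ cong₂ _+_ (∑-pos T (parts (suc k))) (∑-pos T (parts (suc k))) ⟨
    Σ + Σ                             ≈⟨ mod-+ (sum-symmetry k period) (mod-reflexive refl) ⟩
    -1ℤ ^ k * Σ + Σ                   ≡⟨ cong (λ e → -1ℤ ^ e * Σ + Σ) (ℕ.suc-injective k≡) ⟩
    -1ℤ * -1ℤ ^ (c ℕ.* 2) * Σ + Σ     ≡⟨ cong (λ s → -1ℤ * s * Σ + Σ) (-1^even c) ⟩
    -1ℤ * 1ℤ * Σ + Σ                  ≡⟨ cancel Σ ⟩
    0ℤ                                ∎)
    where
    S = sumTo T (parts (suc k))
    Σ = ∑[ i < T ] (+ parts (suc k) i)
    cancel : ∀ x → -1ℤ * 1ℤ * x + x ≡ 0ℤ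
    cancel = solve-∀

open import Defs
open import Data.Nat.Base using (suc; _*_; _<_; _≤_; ≢-nonZero⁻¹)
open import Data.Nat.Divisibility using (_∣_; _∣?_)
open import Data.Nat.GCD using (gcd; gcd-comm; gcd[m,n]≢0)
open import Data.Nat.Coprimality using (Coprime; coprime-divisor; gcd≡1⇒coprime)
open import Data.Nat.Primality using (irreducible[2])
open import Data.Nat.Properties using (≤-antisym; ≮⇒≥; n≢0⇒n>0)
open import Data.Product using (_×_; _,_)
open import Data.Sum using (inj₁; inj₂)
open import Relation.Nullary using (¬_; yes; no; contradiction)
open import Relation.Binary.PropositionalEquality using (_≡_; refl; trans)
open PeriodSums using (N∣q*sum; N∣2*sum)

odd⇒coprime-2 : ∀ {n} → ¬ (2 ∣ n) → Coprime n 2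
odd⇒coprime-2 2∤n (d∣n , d∣2) with irreducible[2] d∣2
... | inj₁ d≡1 = d≡1
... | inj₂ refl = contradiction d∣n 2∤n

gcd≯1⇒coprime : ∀ m n .{{_ : NonZero n}} → ¬ (1 < gcd m n) → Coprime n m
gcd≯1⇒coprime m n gcd≯1 =
  gcd≡1⇒coprime (trans (gcd-comm n m) (≤-antisym (≮⇒≥ gcd≯1) (n≢0⇒n>0 gcd≢0)))
  where
  gcd≢0 = gcd[m,n]≢0 m n (inj₂ (≢-nonZero⁻¹ n))

theorem2p9 : (N : ℕ) .{{_ : NonZero N}} → ¬ (2 ∣ N) →
    (k : ℕ) → 1 ≤ k →
    (T T′ q : ℕ) → IsMinPeriod N k T → IsMinPeriod N (suc k) T′ → T′ ≡ q * T →
    ((¬ (2 ∣ k)) × (1 < gcd q N) → N ∣ q * sumTo T (parts k))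
    × (¬ ((¬ (2 ∣ k)) × (1 < gcd q N)) → N ∣ sumTo T (parts k))
theorem2p9 N odd k 1≤k T T′ q (period , _) (period′ , _) T′≡qT = (λ _ → N∣q*S) , otherwise
  where
  N∣q*S : N ∣ q * sumTo T (parts k)
  N∣q*S = N∣q*sum N k {q = q} period period′ T′≡qT
  otherwise : ¬ ((¬ (2 ∣ k)) × (1 < gcd q N)) → N ∣ sumTo T (parts k)
  otherwise exceptional with 2 ∣? k
  ... | yes 2∣k = coprime-divisor (odd⇒coprime-2 odd) (N∣2*sum N k 1≤k 2∣k period)
  ... | no  2∤k = coprime-divisor (gcd≯1⇒coprime q N (λ gcd>1 → exceptional (2∤k , gcd>1))) N∣q*S
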